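{- If $f\colon[0,1]\to\mathbb{R}$ has a uniformly continuous ternary modulus, then $f$ is uniformly continuous.
   Context: The setting is constructive. Real numbers are regular sequences of rationals $\langle r_n\rangle$ with $|r_n-r_{n+1}|\le2^{ -(n+1)}$. Equality is $\langle r_n\rangle\simeq\langle q_n\rangle$ iff $\forall n\,|r_{n+1}-q_{n+1}|\le2^{ -n}$. Functions $[0,1]\to\mathbb{R}$ respect $\simeq$. For $s\in\{0,1,2\}^*$, define $N(\langle\rangle)=1$ and $N(s*\langle i\rangle)=2N(s)+(i-1)$. For $\alpha\in\{0,1,2\}^{\mathbb{N}}$, $\Phi(\alpha)=\langle2^{ -(n+1)}N(\overline{\alpha}n)\rangle_n$, where $\overline{\alpha}n$ is the initial segment of length $n$. A ternary modulus of $f$ is $g\colon\mathbb{N}\to\{0,1,2\}^{\mathbb{N}}\to\mathbb{N}$ with $\forall k\,\forall\alpha\,\forall x\in[0,1]\,(|\Phi(\alpha)-x|\le2^{ -g_k(\alpha)}\to|f(\Phi(\alpha))-f(x)|\le2^{ -k})$. It is uniformly continuous if each $g_k$ is uniformly continuous: $\exists n\,\forall\alpha,\beta\,(\overline{\alpha}n=\overline{\beta}n\to g_k(\alpha)=g_k(\beta))$. $f$ is uniformly continuous if there is $\omega$ with $\forall k\,\forall x,y\in[0,1]\,(|x-y|\le2^{ -\omega(k)}\to|f(x)-f(y)|\le2^{ -k})$. -}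

module Defs where

open import Data.Nat as ℕ using (ℕ; zero; suc; _<_)
open import Data.Integer as ℤ using (ℤ)
open import Data.Fin using (Fin; toℕ)
open import Data.Rational using (ℚ; 0ℚ; 1ℚ; ½; _+_; _-_; _*_; -_; ∣_∣; _≤_; _/_)
open import Data.Product using (Σ; ∃; _×_)
open import Relation.Binary.PropositionalEquality using (_≡_)

2^-_ : ℕ → ℚ
2^- zero  = 1ℚ
2^- suc n = ½ * (2^- n)

Seq : Set
Seq = ℕ → ℚ

IsReal : Seq → Set
IsReal r = ∀ n → ∣ r n - r (suc n) ∣ ≤ 2^- (suc n)

record ℝ : Set where
  constructor mkℝ
  field
    seq : Seq
    reg : IsReal seq
open ℝ public

_≃_ : Seq → Seq → Set
r ≃ q = ∀ n → ∣ r (suc n) - q (suc n) ∣ ≤ 2^- n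

const : ℚ → Seq
const c _ = c

-- difference: (x - y)_n = x_{n+1} - y_{n+1}  (regular when x, y are)
_⊖_ : Seq → Seq → Seq
(x ⊖ y) n = x (suc n) - y (suc n)

abs : Seq → Seq
abs x n = ∣ x n ∣

-- 0 ≤ x  iff  ∀ n, x_n ≥ -2^{-n}  (since |x - x_n| ≤ 2^{-n})
NonNeg : Seq → Set
NonNeg x = ∀ n → - (2^- n) ≤ x n

_≤ℝ_ : Seq → Seq → Set
x ≤ℝ y = NonNeg (y ⊖ x)

In01 : Seq → Set
In01 x = (const 0ℚ ≤ℝ x) × (x ≤ℝ const 1ℚ)

Close : ℕ → Seq → Seq → Set
Close k x y = abs (x ⊖ y) ≤ℝ const (2^- k)

record Fun01 : Set where
  field
    app : (x : Seq) → IsReal x → In01 x → Seq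
    app-reg : ∀ x rx px → IsReal (app x rx px)
    app-ext : ∀ x y rx ry px py → x ≃ y → app x rx px ≃ app y ry py
open Fun01 public

Tern : Set
Tern = ℕ → Fin 3

Nbar : Tern → ℕ → ℤ
Nbar α zero    = ℤ.+ 1
Nbar α (suc n) = (ℤ.+ 2 ℤ.* Nbar α n) ℤ.+ (ℤ.+ (toℕ (α n)) ℤ.- ℤ.+ 1)

Φ : Tern → Seq
Φ α n = 2^- (suc n) * (Nbar α n / 1)

AgreeUpTo : ℕ → Tern → Tern → Set
AgreeUpTo n α β = ∀ i → i < n → α i ≡ β i

IsTernaryModulus : Fun01 → (ℕ → Tern → ℕ) → Set
IsTernaryModulus f g =
  ∀ k α (rΦ : IsReal (Φ α)) (pΦ : In01 (Φ α)) (x : Seq) (rx : IsReal x) (px : In01 x) →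
    Close (g k α) (Φ α) x →
    Close k (app f (Φ α) rΦ pΦ) (app f x rx px)

IsUCTernary : (ℕ → Tern → ℕ) → Set
IsUCTernary g = ∀ k → ∃ λ n → ∀ α β → AgreeUpTo n α β → g k α ≡ g k β

IsUniformlyContinuous : Fun01 → Set
IsUniformlyContinuous f =
  ∃ λ (ω : ℕ → ℕ) → ∀ k (x y : Seq) (rx : IsReal x) (ry : IsReal y) (px : In01 x) (py : In01 y) →
    Close (ω k) x y → Close k (app f x rx px) (app f y ry py)

-- Since g_{k+1} depends only on a finite prefix of its argument, it takes finitely many
-- values and is bounded by some M.  Given x, y with |x - y| ≤ 2^-(M+1), choose α with
-- |Φ α - x| ≤ 2^-(M+1), its digits picked greedily towards a rational approximation of x.
-- Then x and y both lie within 2^-g_{k+1}(α) of Φ α, so f x and f y lie within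
-- 2^-(k+1) of f (Φ α).
module Submission where

open import Defs
open import Data.Nat as ℕ using (ℕ; zero; suc; _⊔_)
import Data.Nat.Properties as ℕ
open import Data.Integer as ℤ using (ℤ)
import Data.Integer.Properties as ℤ
open import Data.Integer.Tactic.RingSolver using (solve-∀)
open import Data.Fin as Fin using (Fin; toℕ)
open import Data.Rational using (ℚ; 0ℚ; 1ℚ; ½; _+_; _-_; _*_; -_; ∣_∣; _≤_; _/_; toℚᵘ)
open import Data.Rational.Properties
open import Data.Rational.Solver using (module +-*-Solver)
import Data.Rational.Unnormalised as ℚᵘ
import Data.Rational.Unnormalised.Properties as ℚᵘ
open import Data.Product using (∃; _×_; _,_; proj₁; proj₂)
open import Data.Sum using (inj₁; inj₂)
open import Function using (_∘_)
open import Relation.Nullary using (yes; no)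
open import Relation.Binary.PropositionalEquality

open +-*-Solver using (solve; con; _:+_; _:-_; _:*_; :-_; _:=_)

private
  variable
    k m n : ℕ
    p q r : ℚ

p≤q⇒0≤q-p : p ≤ q → 0ℚ ≤ q - p
p≤q⇒0≤q-p {p} {q} p≤q = subst (_≤ q - p) (+-inverseʳ p) (+-monoˡ-≤ (- p) p≤q)

≤-byGap : 0ℚ ≤ r → r ≡ q - p → p ≤ q
≤-byGap {r} {q} {p} 0≤r r≡q-p =
  subst₂ _≤_ (+-identityˡ p) (solve 2 (λ p q → q :- p :+ p := q) refl p q)
    (+-monoˡ-≤ p (subst (0ℚ ≤_) r≡q-p 0≤r))

p≤∣p∣ : ∀ p → p ≤ ∣ p ∣
p≤∣p∣ p with ∣p∣≡p∨∣p∣≡-p p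
... | inj₁ ∣p∣≡p  = ≤-reflexive (sym ∣p∣≡p)
... | inj₂ ∣p∣≡-p = ≤-byGap (+-mono-≤ 0≤-p 0≤-p)
  (trans (solve 1 (λ p → :- p :+ :- p := :- p :- p) refl p) (cong (_- p) (sym ∣p∣≡-p)))
  where
  0≤-p : 0ℚ ≤ - p
  0≤-p = subst (0ℚ ≤_) ∣p∣≡-p (0≤∣p∣ p)

∣p∣≤q⇒p≤q : ∣ p ∣ ≤ q → p ≤ q
∣p∣≤q⇒p≤q {p} = ≤-trans (p≤∣p∣ p)

∣p∣≤q⇒-q≤p : ∣ p ∣ ≤ q → - q ≤ p
∣p∣≤q⇒-q≤p {p} {q} ∣p∣≤q =
  ≤-byGap (p≤q⇒0≤q-p -p≤q) (solve 2 (λ p q → q :- :- p := p :- :- q) refl p q)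
  where
  -p≤q : - p ≤ q
  -p≤q = ≤-trans (p≤∣p∣ (- p)) (subst (_≤ q) (sym (∣-p∣≡∣p∣ p)) ∣p∣≤q)

-q≤p≤q⇒∣p∣≤q : - q ≤ p → p ≤ q → ∣ p ∣ ≤ q
-q≤p≤q⇒∣p∣≤q {q} {p} -q≤p p≤q with ∣p∣≡p∨∣p∣≡-p p
... | inj₁ ∣p∣≡p  = subst (_≤ q) (sym ∣p∣≡p) p≤q
... | inj₂ ∣p∣≡-p = subst (_≤ q) (sym ∣p∣≡-p)
  (≤-byGap (p≤q⇒0≤q-p -q≤p) (solve 2 (λ p q → p :- :- q := q :- :- p) refl p q))

∣p-q∣≡∣q-p∣ : ∀ p q → ∣ p - q ∣ ≡ ∣ q - p ∣
∣p-q∣≡∣q-p∣ p q =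
  trans (sym (∣-p∣≡∣p∣ (p - q))) (cong ∣_∣ (solve 2 (λ p q → :- (p :- q) := q :- p) refl p q))

∣p-r∣≤∣p-q∣+∣q-r∣ : ∀ p q r → ∣ p - r ∣ ≤ ∣ p - q ∣ + ∣ q - r ∣
∣p-r∣≤∣p-q∣+∣q-r∣ p q r = subst (λ t → ∣ t ∣ ≤ ∣ p - q ∣ + ∣ q - r ∣)
  (solve 3 (λ p q r → (p :- q) :+ (q :- r) := p :- r) refl p q r) (∣p+q∣≤∣p∣+∣q∣ (p - q) (q - r))

p≤p+q : 0ℚ ≤ q → p ≤ p + q
p≤p+q {q} {p} 0≤q = ≤-byGap 0≤q (solve 2 (λ p q → q := p :+ q :- p) refl p q)

2^-nonNeg : ∀ n → 0ℚ ≤ 2^- n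
2^-nonNeg zero    = nonNegative⁻¹ 1ℚ
2^-nonNeg (suc n) = *-monoˡ-≤-nonNeg ½ (2^-nonNeg n)

2^-suc+2^-suc≡2^- : ∀ n → 2^- suc n + 2^- suc n ≡ 2^- n
2^-suc+2^-suc≡2^- n = trans (sym (*-distribʳ-+ (2^- n) ½ ½)) (*-identityˡ (2^- n))

2^-suc≤2^- : ∀ n → 2^- suc n ≤ 2^- n
2^-suc≤2^- n = subst (2^- suc n ≤_) (2^-suc+2^-suc≡2^- n) (p≤p+q (2^-nonNeg (suc n)))

2^-antitone : m ℕ.≤ n → 2^- n ≤ 2^- m
2^-antitone {n = zero}  ℕ.z≤n = ≤-refl
2^-antitone {n = suc n} ℕ.z≤n = ≤-trans (2^-suc≤2^- n) (2^-antitone {n = n} ℕ.z≤n)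
2^-antitone (ℕ.s≤s m≤n) = *-monoˡ-≤-nonNeg ½ (2^-antitone m≤n)

regular-telescope : ∀ x → IsReal x → ∀ j n → ∣ x n - x (j ℕ.+ n) ∣ ≤ 2^- n - 2^- (j ℕ.+ n)
regular-telescope x _ zero n =
  ≤-reflexive (trans (cong ∣_∣ (+-inverseʳ (x n))) (sym (+-inverseʳ (2^- n))))
regular-telescope x x-reg (suc j) n = begin
  ∣ x n - x (suc i) ∣                        ≤⟨ ∣p-r∣≤∣p-q∣+∣q-r∣ (x n) (x i) (x (suc i)) ⟩
  ∣ x n - x i ∣ + ∣ x i - x (suc i) ∣        ≤⟨ +-mono-≤ (regular-telescope x x-reg j n) (x-reg i) ⟩
  2^- n - 2^- i + 2^- suc i                  ≡⟨ cong (λ t → 2^- n - t + 2^- suc i) (sym (2^-suc+2^-suc≡2^- i)) ⟩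
  2^- n - (2^- suc i + 2^- suc i) + 2^- suc i ≡⟨ solve 2 (λ a t → a :- (t :+ t) :+ t := a :- t) refl (2^- n) (2^- suc i) ⟩
  2^- n - 2^- suc i                          ∎
  where
  open ≤-Reasoning
  i = j ℕ.+ n

regular⇒cauchy : ∀ x → IsReal x → m ℕ.≤ n → ∣ x m - x n ∣ ≤ 2^- m
regular⇒cauchy {m} {n} x x-reg m≤n = ≤-trans
  (subst (λ i → ∣ x m - x i ∣ ≤ 2^- m - 2^- i) (ℕ.m∸n+n≡m m≤n) (regular-telescope x x-reg (n ℕ.∸ m) m))
  (≤-byGap (2^-nonNeg n) (solve 2 (λ a b → b := a :- (a :- b)) refl (2^- m) (2^- n)))

close⇒dist≤ : ∀ k x y → Close k x y → ∀ n → ∣ x (suc (suc n)) - y (suc (suc n)) ∣ ≤ 2^- k + 2^- n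
close⇒dist≤ k x y x≈y n =
  ≤-byGap (p≤q⇒0≤q-p (x≈y n)) (solve 3 (λ a b d → a :- d :- (:- b) := a :+ b :- d) refl (2^- k) (2^- n) d)
  where d = ∣ x (suc (suc n)) - y (suc (suc n)) ∣

dist≤⇒close : ∀ k x y → (∀ n → ∣ x (suc (suc n)) - y (suc (suc n)) ∣ ≤ 2^- k + 2^- n) → Close k x y
dist≤⇒close k x y dist≤ n =
  ≤-byGap (p≤q⇒0≤q-p (dist≤ n)) (solve 3 (λ a b d → a :+ b :- d := a :- d :- (:- b)) refl (2^- k) (2^- n) d)
  where d = ∣ x (suc (suc n)) - y (suc (suc n)) ∣

close-sym : ∀ k x y → Close k x y → Close k y x
close-sym k x y x≈y n =
  subst (λ d → - 2^- n ≤ 2^- k - d) (∣p-q∣≡∣q-p∣ (x (suc (suc n))) (y (suc (suc n)))) (x≈y n)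

close-mono : ∀ x y → m ℕ.≤ k → Close k x y → Close m x y
close-mono x y m≤k x≈y n = ≤-trans (x≈y n) (+-monoˡ-≤ _ (2^-antitone m≤k))

close-fromLaterIndices : ∀ k x y → IsReal x → IsReal y →
  (∀ n → ∃ λ m → suc (suc n) ℕ.≤ m × ∣ x m - y m ∣ ≤ 2^- k + 2^- suc n) → Close k x y
close-fromLaterIndices k x y x-reg y-reg late = dist≤⇒close k x y bound
  where
  bound : ∀ n → ∣ x (suc (suc n)) - y (suc (suc n)) ∣ ≤ 2^- k + 2^- n
  bound n with late n
  ... | m , n₂≤m , x≈ₘy = begin
    ∣ x n₂ - y n₂ ∣
      ≤⟨ ∣p-r∣≤∣p-q∣+∣q-r∣ (x n₂) (x m) (y n₂) ⟩
    ∣ x n₂ - x m ∣ + ∣ x m - y n₂ ∣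
      ≤⟨ +-monoʳ-≤ ∣ x n₂ - x m ∣ (∣p-r∣≤∣p-q∣+∣q-r∣ (x m) (y m) (y n₂)) ⟩
    ∣ x n₂ - x m ∣ + (∣ x m - y m ∣ + ∣ y m - y n₂ ∣)
      ≤⟨ +-mono-≤ (regular⇒cauchy x x-reg n₂≤m) (+-mono-≤ x≈ₘy y≈) ⟩
    t + (c + s + t)
      ≡⟨ solve 3 (λ c s t → t :+ (c :+ s :+ t) := c :+ (s :+ (t :+ t))) refl c s t ⟩
    c + (s + (t + t))
      ≡⟨ cong (λ u → c + (s + u)) (2^-suc+2^-suc≡2^- (suc n)) ⟩
    c + (s + s)
      ≡⟨ cong (c +_) (2^-suc+2^-suc≡2^- n) ⟩
    c + 2^- n
      ∎
    where
    open ≤-Reasoning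
    n₂ = suc (suc n)
    c = 2^- k
    s = 2^- suc n
    t = 2^- n₂
    y≈ : ∣ y m - y n₂ ∣ ≤ t
    y≈ = subst (_≤ t) (∣p-q∣≡∣q-p∣ (y n₂) (y m)) (regular⇒cauchy y y-reg n₂≤m)

close-trans : ∀ k x y z → IsReal x → IsReal z → Close (suc k) x y → Close (suc k) y z → Close k x z
close-trans k x y z x-reg z-reg x≈y y≈z = close-fromLaterIndices k x z x-reg z-reg λ n →
  let n₄ = suc (suc (suc (suc n))) ; a = 2^- suc k ; b = 2^- suc (suc n) in
  n₄ , ℕ.m≤n+m (suc (suc n)) 2 , (begin
    ∣ x n₄ - z n₄ ∣                   ≤⟨ ∣p-r∣≤∣p-q∣+∣q-r∣ (x n₄) (y n₄) (z n₄) ⟩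
    ∣ x n₄ - y n₄ ∣ + ∣ y n₄ - z n₄ ∣ ≤⟨ +-mono-≤ (close⇒dist≤ (suc k) x y x≈y (suc (suc n)))
                                                   (close⇒dist≤ (suc k) y z y≈z (suc (suc n))) ⟩
    (a + b) + (a + b)                 ≡⟨ solve 2 (λ a b → (a :+ b) :+ (a :+ b) := (a :+ a) :+ (b :+ b)) refl a b ⟩
    (a + a) + (b + b)                 ≡⟨ cong₂ _+_ (2^-suc+2^-suc≡2^- k) (2^-suc+2^-suc≡2^- (suc n)) ⟩
    2^- k + 2^- suc n                 ∎)
  where open ≤-Reasoning

pattern down = Fin.zero
pattern stay = Fin.suc Fin.zero
pattern up   = Fin.suc (Fin.suc Fin.zero)

fromℤ : ℤ → ℚ
fromℤ i = i / 1

fromℤ-homo-+ : ∀ i j → fromℤ (i ℤ.+ j) ≡ fromℤ i + fromℤ j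
fromℤ-homo-+ i j = toℚᵘ-injective (begin-equality
  toℚᵘ (fromℤ (i ℤ.+ j))              ≃⟨ toℚᵘ-fromℚᵘ ((i ℤ.+ j) ℚᵘ./ 1) ⟩
  (i ℤ.+ j) ℚᵘ./ 1                     ≡⟨ cong₂ (λ a b → (a ℤ.+ b) ℚᵘ./ 1) (sym (ℤ.*-identityʳ i)) (sym (ℤ.*-identityʳ j)) ⟩
  i ℚᵘ./ 1 ℚᵘ.+ j ℚᵘ./ 1               ≃⟨ ℚᵘ.+-cong (toℚᵘ-fromℚᵘ (i ℚᵘ./ 1)) (toℚᵘ-fromℚᵘ (j ℚᵘ./ 1)) ⟨
  toℚᵘ (fromℤ i) ℚᵘ.+ toℚᵘ (fromℤ j)   ≃⟨ toℚᵘ-homo-+ (fromℤ i) (fromℤ j) ⟨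
  toℚᵘ (fromℤ i + fromℤ j)             ∎)
  where open ℚᵘ.≤-Reasoning

digitValue : Fin 3 → ℚ
digitValue i = fromℤ (ℤ.+ toℕ i ℤ.- ℤ.+ 1)

∣p*digit∣≤∣p∣ : ∀ p i → ∣ p * digitValue i ∣ ≤ ∣ p ∣
∣p*digit∣≤∣p∣ p down = ≤-reflexive (begin
  ∣ p * - 1ℚ ∣   ≡⟨ cong ∣_∣ (neg-distribʳ-* p 1ℚ) ⟨
  ∣ - (p * 1ℚ) ∣ ≡⟨ ∣-p∣≡∣p∣ (p * 1ℚ) ⟩
  ∣ p * 1ℚ ∣     ≡⟨ cong ∣_∣ (*-identityʳ p) ⟩
  ∣ p ∣          ∎)
  where open ≡-Reasoning
∣p*digit∣≤∣p∣ p stay = subst (_≤ ∣ p ∣) (cong ∣_∣ (sym (*-zeroʳ p))) (0≤∣p∣ p)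
∣p*digit∣≤∣p∣ p up   = ≤-reflexive (cong ∣_∣ (*-identityʳ p))

∣2^-*digit∣≤2^- : ∀ n i → ∣ 2^- n * digitValue i ∣ ≤ 2^- n
∣2^-*digit∣≤2^- n i = subst (∣ 2^- n * digitValue i ∣ ≤_) (0≤p⇒∣p∣≡p (2^-nonNeg n)) (∣p*digit∣≤∣p∣ (2^- n) i)

Φ-suc : ∀ α n → Φ α (suc n) ≡ Φ α n + 2^- suc (suc n) * digitValue (α n)
Φ-suc α n = begin
  t * fromℤ (ℤ.+ 2 ℤ.* N ℤ.+ d)        ≡⟨ cong (t *_) (fromℤ-homo-+ (ℤ.+ 2 ℤ.* N) d) ⟩
  t * (fromℤ (ℤ.+ 2 ℤ.* N) + fromℤ d)  ≡⟨ cong (λ u → t * (u + fromℤ d)) (trans (cong fromℤ (2*i≡i+i N)) (fromℤ-homo-+ N N)) ⟩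
  t * ((fromℤ N + fromℤ N) + fromℤ d)  ≡⟨ solve 3 (λ t a b → t :* ((a :+ a) :+ b) := (t :+ t) :* a :+ t :* b) refl t _ _ ⟩
  (t + t) * fromℤ N + t * fromℤ d      ≡⟨ cong (λ u → u * fromℤ N + t * fromℤ d) (2^-suc+2^-suc≡2^- (suc n)) ⟩
  Φ α n + t * digitValue (α n)         ∎
  where
  open ≡-Reasoning
  t = 2^- suc (suc n)
  N = Nbar α n
  d = ℤ.+ toℕ (α n) ℤ.- ℤ.+ 1
  2*i≡i+i : ∀ i → ℤ.+ 2 ℤ.* i ≡ i ℤ.+ i
  2*i≡i+i = solve-∀

Φ-regular : ∀ α → IsReal (Φ α)
Φ-regular α n = begin
  ∣ Φ α n - Φ α (suc n) ∣  ≡⟨ cong (λ u → ∣ Φ α n - u ∣) (Φ-suc α n) ⟩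
  ∣ Φ α n - (Φ α n + e) ∣  ≡⟨ cong ∣_∣ (solve 2 (λ a e → a :- (a :+ e) := :- e) refl (Φ α n) e) ⟩
  ∣ - e ∣                  ≡⟨ ∣-p∣≡∣p∣ e ⟩
  ∣ e ∣                    ≤⟨ ∣2^-*digit∣≤2^- (suc (suc n)) (α n) ⟩
  2^- suc (suc n)          ≤⟨ 2^-suc≤2^- (suc n) ⟩
  2^- suc n                ∎
  where
  open ≤-Reasoning
  e = 2^- suc (suc n) * digitValue (α n)

Φ-centred : ∀ α n → ∣ Φ α n - ½ ∣ + 2^- suc n ≤ ½
Φ-centred α zero    = ≤-refl
Φ-centred α (suc n) = begin
  ∣ Φ α (suc n) - ½ ∣ + t  ≡⟨ cong (λ u → ∣ u - ½ ∣ + t) (Φ-suc α n) ⟩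
  ∣ Φ α n + e - ½ ∣ + t    ≡⟨ cong (λ u → ∣ u ∣ + t) (solve 3 (λ a e h → a :+ e :- h := (a :- h) :+ e) refl (Φ α n) e ½) ⟩
  ∣ (Φ α n - ½) + e ∣ + t  ≤⟨ +-monoˡ-≤ t (∣p+q∣≤∣p∣+∣q∣ (Φ α n - ½) e) ⟩
  ∣ Φ α n - ½ ∣ + ∣ e ∣ + t ≤⟨ +-monoˡ-≤ t (+-monoʳ-≤ ∣ Φ α n - ½ ∣ (∣2^-*digit∣≤2^- (suc (suc n)) (α n))) ⟩
  ∣ Φ α n - ½ ∣ + t + t    ≡⟨ +-assoc ∣ Φ α n - ½ ∣ t t ⟩
  ∣ Φ α n - ½ ∣ + (t + t)  ≡⟨ cong (∣ Φ α n - ½ ∣ +_) (2^-suc+2^-suc≡2^- (suc n)) ⟩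
  ∣ Φ α n - ½ ∣ + 2^- suc n ≤⟨ Φ-centred α n ⟩
  ½                        ∎
  where
  open ≤-Reasoning
  t = 2^- suc (suc n)
  e = t * digitValue (α n)

centred⇒In01 : ∀ x → (∀ n → ∣ x n - ½ ∣ ≤ ½) → In01 x
centred⇒In01 x centred =
  (λ n → ≤-trans (-2^-≤0 n) (lower (suc n))) , (λ n → ≤-trans (-2^-≤0 n) (upper (suc n)))
  where
  -2^-≤0 : ∀ n → - 2^- n ≤ 0ℚ
  -2^-≤0 n = neg-antimono-≤ (2^-nonNeg n)
  lower : ∀ n → 0ℚ ≤ x n - 0ℚ
  lower n = subst (0ℚ ≤_) (trans (solve 2 (λ a h → a :- h :- (:- h) := a) refl (x n) ½) (sym (+-identityʳ (x n))))
    (p≤q⇒0≤q-p (∣p∣≤q⇒-q≤p (centred n)))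
  upper : ∀ n → 0ℚ ≤ 1ℚ - x n
  upper n = subst (0ℚ ≤_) (solve 2 (λ a h → h :- (a :- h) := (h :+ h) :- a) refl (x n) ½)
    (p≤q⇒0≤q-p (∣p∣≤q⇒p≤q (centred n)))

Φ-In01 : ∀ α → In01 (Φ α)
Φ-In01 α = centred⇒In01 (Φ α) λ n → ≤-trans (p≤p+q (2^-nonNeg (suc n))) (Φ-centred α n)

digitToward : ℚ → ℚ → Fin 3
digitToward e s with ∣ e ∣ ≤? s | e ≤? 0ℚ
... | yes _ | _     = stay
... | no _  | yes _ = up
... | no _  | no _  = down

e≤0⇒∣e+s∣≤s+E : ∀ {E e s} → 0ℚ ≤ E → e ≤ 0ℚ → ∣ e ∣ ≤ (s + s) + E → ∣ e + s ∣ ≤ s + E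
e≤0⇒∣e+s∣≤s+E {E} {e} {s} 0≤E e≤0 ∣e∣≤ = -q≤p≤q⇒∣p∣≤q lower upper
  where
  lower : - (s + E) ≤ e + s
  lower = ≤-byGap (p≤q⇒0≤q-p (∣p∣≤q⇒-q≤p ∣e∣≤))
    (solve 3 (λ e s E → e :- :- ((s :+ s) :+ E) := (e :+ s) :- :- (s :+ E)) refl e s E)
  upper : e + s ≤ s + E
  upper = ≤-byGap (+-mono-≤ (p≤q⇒0≤q-p e≤0) 0≤E)
    (solve 3 (λ e s E → con 0ℚ :- e :+ E := (s :+ E) :- (e :+ s)) refl e s E)

digitToward-correct : ∀ {E} e s → 0ℚ ≤ E → ∣ e ∣ ≤ (s + s) + E →
  ∣ e + s * digitValue (digitToward e s) ∣ ≤ s + E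
digitToward-correct {E} e s 0≤E ∣e∣≤ with ∣ e ∣ ≤? s | e ≤? 0ℚ
... | yes ∣e∣≤s | _ = subst (_≤ s + E) (cong ∣_∣ e≡e+s*0) (≤-trans ∣e∣≤s (p≤p+q 0≤E))
  where
  e≡e+s*0 : e ≡ e + s * 0ℚ
  e≡e+s*0 = sym (trans (cong (e +_) (*-zeroʳ s)) (+-identityʳ e))
... | no _ | yes e≤0 = subst (λ u → ∣ e + u ∣ ≤ s + E) (sym (*-identityʳ s)) (e≤0⇒∣e+s∣≤s+E 0≤E e≤0 ∣e∣≤)
... | no _ | no e≰0  = subst (_≤ s + E) ∣-e+s∣≡∣e-s∣ (e≤0⇒∣e+s∣≤s+E 0≤E -e≤0 ∣-e∣≤)
  where
  -e≤0 : - e ≤ 0ℚ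
  -e≤0 = neg-antimono-≤ (<⇒≤ (≰⇒> e≰0))
  ∣-e∣≤ : ∣ - e ∣ ≤ (s + s) + E
  ∣-e∣≤ = subst (_≤ (s + s) + E) (sym (∣-p∣≡∣p∣ e)) ∣e∣≤
  ∣-e+s∣≡∣e-s∣ : ∣ - e + s ∣ ≡ ∣ e + s * - 1ℚ ∣
  ∣-e+s∣≡∣e-s∣ = trans (sym (∣-p∣≡∣p∣ (- e + s)))
    (cong ∣_∣ (solve 2 (λ e s → :- (:- e :+ s) := e :+ s :* (:- con 1ℚ)) refl e s))

module _ (q : ℚ) where

  greedyValue : ℕ → ℚ
  greedyDigits : Tern

  greedyValue zero    = ½
  greedyValue (suc n) = greedyValue n + 2^- suc (suc n) * digitValue (greedyDigits n)

  greedyDigits n = digitToward (greedyValue n - q) (2^- suc (suc n))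

Φ-greedyDigits : ∀ q n → Φ (greedyDigits q) n ≡ greedyValue q n
Φ-greedyDigits q zero    = refl
Φ-greedyDigits q (suc n) = trans (Φ-suc (greedyDigits q) n)
  (cong (_+ 2^- suc (suc n) * digitValue (greedyDigits q n)) (Φ-greedyDigits q n))

greedyValue-error : ∀ {E q} → 0ℚ ≤ E → ∣ ½ - q ∣ ≤ ½ + E → ∀ n → ∣ greedyValue q n - q ∣ ≤ 2^- suc n + E
greedyValue-error 0≤E ∣½-q∣≤ zero = ∣½-q∣≤
greedyValue-error {E} {q} 0≤E ∣½-q∣≤ (suc n) =
  subst (λ u → ∣ u ∣ ≤ t + E) (solve 3 (λ v q e → v :- q :+ e := v :+ e :- q) refl v q (t * digitValue (greedyDigits q n)))
    (digitToward-correct (v - q) t 0≤E ∣v-q∣≤)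
  where
  v = greedyValue q n
  t = 2^- suc (suc n)
  ∣v-q∣≤ : ∣ v - q ∣ ≤ (t + t) + E
  ∣v-q∣≤ = subst (λ u → ∣ v - q ∣ ≤ u + E) (sym (2^-suc+2^-suc≡2^- (suc n))) (greedyValue-error 0≤E ∣½-q∣≤ n)

In01⇒∣½-x∣≤ : ∀ x → In01 x → ∀ n → ∣ ½ - x (suc n) ∣ ≤ ½ + 2^- n
In01⇒∣½-x∣≤ x (0≤x , x≤1) n = -q≤p≤q⇒∣p∣≤q lower upper
  where
  lower : - (½ + 2^- n) ≤ ½ - x (suc n)
  lower = ≤-byGap (p≤q⇒0≤q-p (x≤1 n))
    (solve 3 (λ h a b → (h :+ h) :- a :- :- b := h :- a :- :- (h :+ b)) refl ½ (x (suc n)) (2^- n))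
  upper : ½ - x (suc n) ≤ ½ + 2^- n
  upper = ≤-byGap (p≤q⇒0≤q-p (0≤x n))
    (solve 3 (λ h a b → a :- con 0ℚ :- :- b := (h :+ b) :- (h :- a)) refl ½ (x (suc n)) (2^- n))

Φ-approximates : ∀ M x → IsReal x → In01 x → ∃ λ α → Close (suc M) (Φ α) x
Φ-approximates M x x-reg x-In01 = α , close-fromLaterIndices (suc M) (Φ α) x (Φ-regular α) x-reg λ n →
  let m = suc (suc n) ℕ.+ P in
  m , ℕ.m≤m+n (suc (suc n)) P , (begin
    ∣ Φ α m - x m ∣              ≤⟨ ∣p-r∣≤∣p-q∣+∣q-r∣ (Φ α m) xₚ (x m) ⟩
    ∣ Φ α m - xₚ ∣ + ∣ xₚ - x m ∣  ≤⟨ +-mono-≤ (Φα≈xₚ m) (regular⇒cauchy x x-reg (ℕ.m≤n+m P (suc (suc n)))) ⟩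
    2^- suc m + E + 2^- P        ≡⟨ +-assoc (2^- suc m) E (2^- P) ⟩
    2^- suc m + (E + 2^- P)      ≤⟨ +-mono-≤ (2^-antitone (ℕ.s≤s (ℕ.m≤n⇒m≤1+n (ℕ.m≤n⇒m≤1+n (ℕ.m≤m+n n P)))))
                                             (+-monoʳ-≤ E (2^-suc≤2^- (suc (suc M)))) ⟩
    2^- suc n + (E + E)          ≡⟨ cong (2^- suc n +_) (2^-suc+2^-suc≡2^- (suc M)) ⟩
    2^- suc n + 2^- suc M        ≡⟨ +-comm (2^- suc n) (2^- suc M) ⟩
    2^- suc M + 2^- suc n        ∎)
  where
  open ≤-Reasoning
  -- The digits aim at the rational xₚ, which is within 2^-(M+2) of x and of [0,1].
  E = 2^- suc (suc M)
  P = suc (suc (suc M))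
  xₚ = x P
  α = greedyDigits xₚ
  Φα≈xₚ : ∀ n → ∣ Φ α n - xₚ ∣ ≤ 2^- suc n + E
  Φα≈xₚ n = subst (λ u → ∣ u - xₚ ∣ ≤ 2^- suc n + E) (sym (Φ-greedyDigits xₚ n))
    (greedyValue-error (2^-nonNeg (suc (suc M))) (In01⇒∣½-x∣≤ x x-In01 (suc (suc M))) n)

_∷ᵗ_ : Fin 3 → Tern → Tern
(i ∷ᵗ α) zero    = i
(i ∷ᵗ α) (suc n) = α n

PrefixDetermined : ℕ → (Tern → ℕ) → Set
PrefixDetermined n G = ∀ α β → AgreeUpTo n α β → G α ≡ G β

≤⊔³ : ∀ (f : Fin 3 → ℕ) i → f i ℕ.≤ f down ⊔ f stay ⊔ f up
≤⊔³ f down = ℕ.≤-trans (ℕ.m≤m⊔n (f down) (f stay)) (ℕ.m≤m⊔n _ (f up))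
≤⊔³ f stay = ℕ.≤-trans (ℕ.m≤n⊔m (f down) (f stay)) (ℕ.m≤m⊔n _ (f up))
≤⊔³ f up   = ℕ.m≤n⊔m (f down ⊔ f stay) (f up)

prefixDetermined⇒bounded : ∀ n G → PrefixDetermined n G → ∃ λ M → ∀ α → G α ℕ.≤ M
prefixDetermined⇒bounded zero G G-det = G (λ _ → stay) , λ α → ℕ.≤-reflexive (G-det α (λ _ → stay) λ _ ())
prefixDetermined⇒bounded (suc n) G G-det = bound down ⊔ bound stay ⊔ bound up , λ α → begin
  G α                    ≡⟨ G-det α (α 0 ∷ᵗ (α ∘ suc)) (λ { zero _ → refl ; (suc _) _ → refl }) ⟩
  G (α 0 ∷ᵗ (α ∘ suc))   ≤⟨ proj₂ (branch (α 0)) (α ∘ suc) ⟩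
  bound (α 0)            ≤⟨ ≤⊔³ bound (α 0) ⟩
  bound down ⊔ bound stay ⊔ bound up ∎
  where
  open ℕ.≤-Reasoning
  branch : ∀ i → ∃ λ M → ∀ α → G (i ∷ᵗ α) ℕ.≤ M
  branch i = prefixDetermined⇒bounded n (G ∘ (i ∷ᵗ_)) λ α β α≈β →
    G-det (i ∷ᵗ α) (i ∷ᵗ β) λ { zero _ → refl ; (suc j) (ℕ.s≤s j<n) → α≈β j j<n }
  bound : Fin 3 → ℕ
  bound i = proj₁ (branch i)

lemma5p8 : (f : Fun01) → (∃ λ (g : ℕ → Tern → ℕ) → IsTernaryModulus f g × IsUCTernary g) → IsUniformlyContinuous f
lemma5p8 f (g , g-modulus , g-uc) = ω , ω-modulus
  where
  bounded : ∀ k → ∃ λ M → ∀ α → g (suc k) α ℕ.≤ M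
  bounded k = prefixDetermined⇒bounded _ (g (suc k)) (proj₂ (g-uc (suc k)))

  ω : ℕ → ℕ
  ω k = suc (proj₁ (bounded k))

  ω-modulus : ∀ k x y (rx : IsReal x) (ry : IsReal y) (px : In01 x) (py : In01 y) →
              Close (ω k) x y → Close k (app f x rx px) (app f y ry py)
  ω-modulus k x y rx ry px py x≈y =
    close-trans k fx fΦ fy (app-reg f x rx px) (app-reg f y ry py) (close-sym (suc k) fΦ fx fΦ≈fx) fΦ≈fy
    where
    M = proj₁ (bounded k)
    α = proj₁ (Φ-approximates M x rx px)
    Φ≈x : Close (suc M) (Φ α) x
    Φ≈x = proj₂ (Φ-approximates M x rx px)
    Φ≈y : Close M (Φ α) y
    Φ≈y = close-trans M (Φ α) x y (Φ-regular α) ry Φ≈x x≈y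
    g≤M : g (suc k) α ℕ.≤ M
    g≤M = proj₂ (bounded k) α
    fx = app f x rx px
    fy = app f y ry py
    fΦ = app f (Φ α) (Φ-regular α) (Φ-In01 α)
    fΦ≈fx : Close (suc k) fΦ fx
    fΦ≈fx = g-modulus (suc k) α (Φ-regular α) (Φ-In01 α) x rx px (close-mono (Φ α) x (ℕ.m≤n⇒m≤1+n g≤M) Φ≈x)
    fΦ≈fy : Close (suc k) fΦ fy
    fΦ≈fy = g-modulus (suc k) α (Φ-regular α) (Φ-In01 α) y ry py (close-mono (Φ α) y g≤M Φ≈y)
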